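{- Let a finite group $\Gamma$ act on a finite set $X$ with $|\Gamma|\le m!$, and consider a run of the Construction described below which performs $k-1$ iterations, producing the labelling $\phi:X\to\{1,\dots,k\}$, groups $\Gamma_1\supseteq\cdots\supseteq\Gamma_k$ and sets $X_1\supseteq\cdots\supseteq X_k$. Let $2\le j\le k$ and let $y_1,\dots,y_j\in X$ satisfy (1) $\phi(y_i)=i$ for each $i$, and (2) $y_{i+1}\in\Gamma_{i-1}.y_i$ for each $i$ from $2$ to $j-1$, and $y_1\in\Gamma_{j-1}.y_j$. Then $j\le m$ and $|\Gamma_{i-1}.y_i|\ge j-i+2$ for each $i$ from $2$ to $j$.
   Context: For a group $H$ acting on a set $Y$, write $h.y$ for the action, $H.y$ for the orbit, and $\mathrm{Stab}_H(Z)=\{h\in H: h.z=z \text{ for all } z\in Z\}$. Construction: (1) Set $i=1$, $\phi(x)=1$ for all $x\in X$, $\Gamma_1=\Gamma$, $X_1=X$. (2) While some element of $\Gamma_i$ moves some element of $X_i$: (a) choose a subset $X'_{i+1}\subseteq X_i$ containing exactly one element from each $\Gamma_i$-orbit in $X_i$ having at least two elements (and no other elements); (b) set $\phi(x)=i+1$ for each $x\in X'_{i+1}$; (c) set $X_{i+1}=X_i\setminus X'_{i+1}$ and $\Gamma_{i+1}=\mathrm{Stab}_{\Gamma_i}(X'_{i+1})$; (d) increase $i$ by $1$. -}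

module Defs where

open import Level using (Level; _⊔_)
open import Algebra.Bundles using (Group)
open import Data.Nat using (ℕ; zero; suc; _≤_; _<_)
open import Data.Fin using (Fin)
open import Data.Product using (Σ; ∃; _×_)
open import Data.Unit using (⊤)
open import Relation.Binary.PropositionalEquality using (_≡_; _≢_)
open import Relation.Nullary using (¬_)
open import Function.Definitions using (Injective)

-- A finite group Γ (a stdlib Group whose carrier is in bijection with
-- Fin order, so |Γ| = order) acting on the finite set X = Fin n.
record FiniteGroupAction (c ℓ : Level) : Set (Level.suc (c ⊔ ℓ)) where
  field
    Γ : Group c ℓ
  open Group Γ public
  field
    n       : ℕ
    act     : Carrier → Fin n → Fin n
    act-cong : ∀ {g h} → g ≈ h → ∀ x → act g x ≡ act h x
    act-ε   : ∀ x → act ε x ≡ x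
    act-∙   : ∀ g h x → act (g ∙ h) x ≡ act g (act h x)
    order   : ℕ
    enum    : Fin order → Carrier
    enum-inj  : ∀ a b → enum a ≈ enum b → a ≡ b
    enum-surj : ∀ g → ∃ λ a → enum a ≈ g

AtLeast : ∀ {a n} → ℕ → (Fin n → Set a) → Set a
AtLeast {n = n} N S = Σ (Fin N → Fin n) λ f → Injective _≡_ _≡_ f × (∀ a → S (f a))

module Run {c ℓ} (A : FiniteGroupAction c ℓ) (φ : Fin (FiniteGroupAction.n A) → ℕ) where
  open FiniteGroupAction A

  -- A run of the construction is recorded by its labelling φ:
  -- X'_{i+1} = { x | φ x ≡ i+1 } for i ≥ 1.
  -- Γ_i (membership predicate), for i ≥ 1 (index 0 unused, set equal to Γ_1):
  -- Γ_1 = Γ, Γ_{i+1} = Stab_{Γ_i}(X'_{i+1}).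
  Gam : ℕ → Carrier → Set (c ⊔ ℓ)
  Gam zero          g = Level.Lift _ ⊤
  Gam (suc zero)    g = Level.Lift _ ⊤
  Gam (suc (suc i)) g = Gam (suc i) g × Level.Lift (c ⊔ ℓ) (∀ x → φ x ≡ suc (suc i) → act g x ≡ x)

  Xs : ℕ → Fin n → Set
  Xs zero          x = ⊤
  Xs (suc zero)    x = ⊤
  Xs (suc (suc i)) x = Xs (suc i) x × φ x ≢ suc (suc i)

  Orb : ℕ → Fin n → Fin n → Set (c ⊔ ℓ)
  Orb i x y = Σ Carrier λ g → Gam i g × act g x ≡ y

  Nontrivial : ℕ → Fin n → Set (c ⊔ ℓ)
  Nontrivial i x = Σ (Fin n) λ y → Orb i x y × y ≢ x

  Moves : ℕ → Set (c ⊔ ℓ)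
  Moves i = Σ Carrier λ g → Σ (Fin n) λ x → Gam i g × Xs i x × act g x ≢ x

  ValidStep : ℕ → Set (c ⊔ ℓ)
  ValidStep i =
      (∀ x → φ x ≡ suc i → Xs i x × Nontrivial i x)
    × (∀ x → Xs i x → Nontrivial i x → Σ (Fin n) λ s → φ s ≡ suc i × Orb i x s)
    × (∀ s t → φ s ≡ suc i → φ t ≡ suc i → Orb i s t → s ≡ t)

record IsRun {c ℓ} (A : FiniteGroupAction c ℓ) (k : ℕ)
             (φ : Fin (FiniteGroupAction.n A) → ℕ) : Set (c ⊔ ℓ) where
  open Run A φ
  field
    range    : ∀ x → 1 ≤ φ x × φ x ≤ k
    steps    : ∀ i → 1 ≤ i → i < k → Moves i × ValidStep i
    stops    : ¬ Moves k

{-# OPTIONS --safe #-}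
module Submission where

-- Γ_i fixes y_i, which lies in X'_i, so by orbit–stabiliser |Γ_{i-1}| ≥ |Γ_{i-1}.y_i| · |Γ_i|.
-- Chaining the orbit relations, Γ_{i-1}.y_i contains y_i, …, y_j and y_1, which are distinct
-- because φ separates them; hence it has at least j - i + 2 elements, and multiplying over
-- i = 2, …, j gives j! ≤ |Γ| ≤ m!, so j ≤ m.

open import Defs
open import Level using (Level; _⊔_; lift)
open import Data.Nat using (ℕ; zero; suc; _≤_; _<_; _+_; _∸_; _!; _*_; z≤n; s≤s; s≤s⁻¹)
import Data.Nat.Properties as ℕ
open import Data.Fin using (Fin; zero; suc; toℕ; remQuot)
import Data.Fin.Properties as Fin
open import Data.Product using (_×_; _,_; proj₁; proj₂; Σ)
open import Data.Sum using (inj₁; inj₂)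
open import Function using (_∘_)
open import Function.Bundles using (Injection)
open import Function.Definitions using (Injective)
open import Function.Properties.Inverse using (↔⇒↣)
open import Relation.Binary.PropositionalEquality as ≡ using (_≡_; refl; cong; subst)
open import Relation.Nullary using (contradiction)
import Algebra.Properties.Group as GroupProperties

!-mono-≤ : ∀ {m n} → m ≤ n → m ! ≤ n !
!-mono-≤ {n = n} z≤n        = ℕ.1≤n! n
!-mono-≤         (s≤s m≤n) = ℕ.*-mono-≤ (s≤s m≤n) (!-mono-≤ m≤n)

n!<[1+n]! : ∀ {n} → 1 ≤ n → n ! < suc n !
n!<[1+n]! {n} 1≤n = ℕ.m<m+n (n !) (ℕ.*-mono-≤ 1≤n (ℕ.1≤n! n))

!-cancel-≤ : ∀ {m n} → 2 ≤ n → n ! ≤ m ! → n ≤ m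
!-cancel-≤ {m} {suc n} (s≤s 1≤n) [1+n]!≤m! = ℕ.≮⇒≥ λ m<1+n →
  ℕ.<⇒≱ (ℕ.≤-<-trans (!-mono-≤ (s≤s⁻¹ m<1+n)) (n!<[1+n]! 1≤n)) [1+n]!≤m!

module GroupAction {c ℓ} (A : FiniteGroupAction c ℓ) where
  open FiniteGroupAction A
    hiding (refl)
    renaming (sym to ≈-sym; trans to ≈-trans; reflexive to ≈-reflexive)
  open GroupProperties Γ using (∙-cancelˡ)

  AtLeastᴳ : ∀ {p} → ℕ → (Carrier → Set p) → Set (c ⊔ ℓ ⊔ p)
  AtLeastᴳ N P = Σ (Fin N → Carrier) λ f → Injective _≡_ _≈_ f × (∀ a → P (f a))

  Orbit : ∀ {p} → (Carrier → Set p) → Fin n → Fin n → Set (c ⊔ p)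
  Orbit H x y = Σ Carrier λ g → H g × act g x ≡ y

  AtLeastᴳ⇒≤order : ∀ {p N} {P : Carrier → Set p} → AtLeastᴳ N P → N ≤ order
  AtLeastᴳ⇒≤order {N = N} (f , f-injective , _) = Fin.injective⇒≤ index-injective
    where
      index : Fin N → Fin order
      index a = proj₁ (enum-surj (f a))

      index-injective : Injective _≡_ _≡_ index
      index-injective {a} {b} eq = f-injective
        (≈-trans (≈-sym (proj₂ (enum-surj (f a))))
                 (≈-trans (≈-reflexive (cong enum eq)) (proj₂ (enum-surj (f b)))))

  -- g k sends x to g x for k ∈ K, so g k determines g x, hence g, and then k by cancellation.
  orbit×stabiliser : ∀ {p q r N} {H : Carrier → Set p} {K : Carrier → Set q} {x}
    → (∀ {g h} → H g → H h → H (g ∙ h)) → (∀ {g} → K g → H g) → (∀ {g} → K g → act g x ≡ x)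
    → AtLeast r (Orbit H x) → AtLeastᴳ N K → AtLeastᴳ (r * N) H
  orbit×stabiliser {r = r} {N} {H} {x = x} H-∙ K⊆H K-fixes
                   (f , f-injective , f-orbit) (k , k-injective , k∈K) =
    product ∘ remQuot N , remQuot-injective ∘ product-injective , product∈H ∘ remQuot N
    where
      remQuot-injective : Injective _≡_ _≡_ (remQuot {r} N)
      remQuot-injective = Injection.injective (↔⇒↣ Fin.*↔×)

      g : Fin r → Carrier
      g t = proj₁ (f-orbit t)

      product : Fin r × Fin N → Carrier
      product (t , a) = g t ∙ k a

      product∈H : ∀ ta → H (product ta)
      product∈H (t , a) = H-∙ (proj₁ (proj₂ (f-orbit t))) (K⊆H (k∈K a))

      product-x : ∀ t a → act (g t ∙ k a) x ≡ f t
      product-x t a = begin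
        act (g t ∙ k a) x       ≡⟨ act-∙ (g t) (k a) x ⟩
        act (g t) (act (k a) x) ≡⟨ cong (act (g t)) (K-fixes (k∈K a)) ⟩
        act (g t) x             ≡⟨ proj₂ (proj₂ (f-orbit t)) ⟩
        f t                     ∎
        where open ≡.≡-Reasoning

      product-injective : Injective _≡_ _≈_ product
      product-injective {t , a} {u , b} eq
        with refl ← f-injective
                      (≡.trans (≡.sym (product-x t a)) (≡.trans (act-cong eq x) (product-x u b)))
        with refl ← k-injective (∙-cancelˡ (g t) (k a) (k b) eq)
        = refl

module Levels {c ℓ} (A : FiniteGroupAction c ℓ) (φ : Fin (FiniteGroupAction.n A) → ℕ) where
  open FiniteGroupAction A using (n; ε; _∙_; act; act-ε; act-∙)
  open Run A φ
  open GroupAction A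

  Gam-ε : ∀ s → Gam s ε
  Gam-ε zero          = lift _
  Gam-ε (suc zero)    = lift _
  Gam-ε (suc (suc s)) = Gam-ε (suc s) , lift λ x _ → act-ε x

  Gam-∙ : ∀ s {g h} → Gam s g → Gam s h → Gam s (g ∙ h)
  Gam-∙ zero          _ _ = lift _
  Gam-∙ (suc zero)    _ _ = lift _
  Gam-∙ (suc (suc s)) {g} {h} (g∈Γ , lift g-fixes) (h∈Γ , lift h-fixes) =
    Gam-∙ (suc s) g∈Γ h∈Γ ,
    lift λ x φx → ≡.trans (act-∙ g h x) (≡.trans (cong (act g) (h-fixes x φx)) (g-fixes x φx))

  Gam-suc⊆ : ∀ s {g} → Gam (suc s) g → Gam s g
  Gam-suc⊆ zero    _         = lift _
  Gam-suc⊆ (suc s) (g∈Γ , _) = g∈Γ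

  Gam-antitone : ∀ {s t g} → s ≤ t → Gam t g → Gam s g
  Gam-antitone {t = zero} z≤n g∈Γ = g∈Γ
  Gam-antitone {t = suc t} s≤1+t g∈Γ with ℕ.m≤n⇒m<n∨m≡n s≤1+t
  ... | inj₁ s<1+t = Gam-antitone (s≤s⁻¹ s<1+t) (Gam-suc⊆ t g∈Γ)
  ... | inj₂ refl  = g∈Γ

  Gam-fixes : ∀ {s g x} → 1 ≤ s → Gam (suc s) g → φ x ≡ suc s → act g x ≡ x
  Gam-fixes {suc s} {x = x} _ (_ , lift fixes) = fixes x

  Orb-refl : ∀ s x → Orb s x x
  Orb-refl s x = ε , Gam-ε s , act-ε x

  Orb-trans : ∀ s {x y z} → Orb s x y → Orb s y z → Orb s x z
  Orb-trans s {x} (g , g∈Γ , gx≡y) (h , h∈Γ , hy≡z) =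
    h ∙ g , Gam-∙ s h∈Γ g∈Γ , ≡.trans (act-∙ h g x) (≡.trans (cong (act h) gx≡y) hy≡z)

  Orb-antitone : ∀ {s t x y} → s ≤ t → Orb t x y → Orb s x y
  Orb-antitone s≤t (g , g∈Γ , gx≡y) = g , Gam-antitone s≤t g∈Γ , gx≡y

  module Cycle (j : ℕ) (y : ℕ → Fin n)
    (y-level : ∀ i → 1 ≤ i → i ≤ j → φ (y i) ≡ i)
    (y-step  : ∀ i → 2 ≤ i → i + 1 ≤ j → Orb (i ∸ 1) (y i) (y (suc i)))
    (y-close : Orb (j ∸ 1) (y j) (y 1))
    where

    y-injective : ∀ {a b} → 1 ≤ a → a ≤ j → 1 ≤ b → b ≤ j → y a ≡ y b → a ≡ b
    y-injective {a} {b} 1≤a a≤j 1≤b b≤j ya≡yb =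
      ≡.trans (≡.sym (y-level a 1≤a a≤j)) (≡.trans (cong φ ya≡yb) (y-level b 1≤b b≤j))

    step-in-orbit : ∀ {s l} → 1 ≤ s → s < l → l < j → Orb s (y l) (y (suc l))
    step-in-orbit {s} {l} 1≤s s<l l<j = Orb-antitone (ℕ.∸-monoˡ-≤ 1 s<l)
      (y-step l (ℕ.≤-trans (s≤s 1≤s) s<l) (subst (_≤ j) (ℕ.+-comm 1 l) l<j))

    later-in-orbit : ∀ {s} t → 1 ≤ s → t + suc s ≤ j → Orb s (y (suc s)) (y (t + suc s))
    later-in-orbit {s} zero    _   _       = Orb-refl s (y (suc s))
    later-in-orbit {s} (suc t) 1≤s t+s<j = Orb-trans s
      (later-in-orbit t 1≤s (ℕ.<⇒≤ t+s<j)) (step-in-orbit 1≤s (ℕ.m≤n+m (suc s) t) t+s<j)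

    first-in-orbit : ∀ {s} → 1 ≤ s → suc s ≤ j → Orb s (y (suc s)) (y 1)
    first-in-orbit {s} 1≤s s<j = Orb-trans s
      (subst (Orb s (y (suc s)) ∘ y) j-s+s≡j (later-in-orbit (j ∸ suc s) 1≤s (ℕ.≤-reflexive j-s+s≡j)))
      (Orb-antitone (ℕ.∸-monoˡ-≤ 1 s<j) y-close)
      where
        j-s+s≡j : j ∸ suc s + suc s ≡ j
        j-s+s≡j = ℕ.m∸n+n≡m s<j

    -- The orbit contains y₁ and y_{s+1}, …, y_j, which lie on distinct levels.
    orbit-atLeast : ∀ {s d} → 1 ≤ s → d + suc s ≡ j → AtLeast (suc (suc d)) (Orb s (y (suc s)))
    orbit-atLeast {s} {d} 1≤s d+s≡j = y ∘ label , y∘label-injective , label-in-orbit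
      where
        label : Fin (suc (suc d)) → ℕ
        label zero    = 1
        label (suc t) = toℕ t + suc s

        1<label-suc : ∀ t → 1 < toℕ t + suc s
        1<label-suc t = ℕ.≤-trans (s≤s 1≤s) (ℕ.m≤n+m (suc s) (toℕ t))

        label-suc≤j : ∀ t → toℕ t + suc s ≤ j
        label-suc≤j t = subst (_ ≤_) d+s≡j (ℕ.+-monoˡ-≤ (suc s) (Fin.toℕ≤pred[n] t))

        label-bounds : ∀ t → 1 ≤ label t × label t ≤ j
        label-bounds zero    = ℕ.≤-refl , ℕ.≤-trans (s≤s z≤n) (label-suc≤j zero)
        label-bounds (suc t) = ℕ.<⇒≤ (1<label-suc t) , label-suc≤j t

        label-injective : Injective _≡_ _≡_ label
        label-injective {zero}  {zero}  _  = refl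
        label-injective {zero}  {suc u} eq = contradiction eq (ℕ.<⇒≢ (1<label-suc u))
        label-injective {suc t} {zero}  eq = contradiction (≡.sym eq) (ℕ.<⇒≢ (1<label-suc t))
        label-injective {suc t} {suc u} eq = cong suc (Fin.toℕ-injective (ℕ.+-cancelʳ-≡ (suc s) _ _ eq))

        y∘label-injective : Injective _≡_ _≡_ (y ∘ label)
        y∘label-injective {t} {u} = label-injective ∘
          y-injective (proj₁ (label-bounds t)) (proj₂ (label-bounds t))
                      (proj₁ (label-bounds u)) (proj₂ (label-bounds u))

        label-in-orbit : ∀ t → Orb s (y (suc s)) (y (label t))
        label-in-orbit zero    = first-in-orbit 1≤s (label-suc≤j zero)
        label-in-orbit (suc t) = later-in-orbit (toℕ t) 1≤s (label-suc≤j t)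

    -- Here d = j - s; each step down multiplies by |Γ_s.y_{s+1}| ≥ d + 2.
    stabiliser-chain : ∀ {s} d → 1 ≤ s → d + s ≡ j → AtLeastᴳ (suc d !) (Gam s)
    stabiliser-chain {s} zero    _   _     =
      (λ _ → ε) , (λ { {zero} {zero} _ → refl }) , (λ _ → Gam-ε s)
    stabiliser-chain {s} (suc d) 1≤s d+s≡j =
      orbit×stabiliser (Gam-∙ s) (Gam-suc⊆ s)
        (λ g∈Γ → Gam-fixes 1≤s g∈Γ (y-level (suc s) (s≤s z≤n) s<j))
        (orbit-atLeast 1≤s d+s+1≡j) (stabiliser-chain d (s≤s z≤n) d+s+1≡j)
      where
        d+s+1≡j : d + suc s ≡ j
        d+s+1≡j = ≡.trans (ℕ.+-suc d s) d+s≡j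

        s<j : suc s ≤ j
        s<j = subst (suc s ≤_) d+s+1≡j (ℕ.m≤n+m (suc s) d)

corollary2p11 : ∀ {c ℓ : Level} (A : FiniteGroupAction c ℓ) (m k : ℕ)
    → FiniteGroupAction.order A ≤ m !
    → (φ : Fin (FiniteGroupAction.n A) → ℕ) → IsRun A k φ
    → (j : ℕ) → 2 ≤ j → j ≤ k
    → (y : ℕ → Fin (FiniteGroupAction.n A))
    → (∀ i → 1 ≤ i → i ≤ j → φ (y i) ≡ i)
    → (∀ i → 2 ≤ i → i + 1 ≤ j → Run.Orb A φ (i ∸ 1) (y i) (y (suc i)))
    → Run.Orb A φ (j ∸ 1) (y j) (y 1)
    → j ≤ m × (∀ i → 2 ≤ i → i ≤ j → AtLeast (j ∸ i + 2) (Run.Orb A φ (i ∸ 1) (y i)))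
corollary2p11 A m _ |Γ|≤m! φ _ j 2≤j@(s≤s (s≤s _)) _ y y-level y-step y-close =
  j≤m , orbit-bound
  where
    open GroupAction A
    open Levels A φ
    open Cycle j y y-level y-step y-close

    j≤m : j ≤ m
    j≤m = !-cancel-≤ 2≤j (ℕ.≤-trans
      (AtLeastᴳ⇒≤order (stabiliser-chain (j ∸ 1) ℕ.≤-refl (ℕ.m∸n+n≡m (ℕ.<⇒≤ 2≤j)))) |Γ|≤m!)

    orbit-bound : ∀ i → 2 ≤ i → i ≤ j → AtLeast (j ∸ i + 2) (Run.Orb A φ (i ∸ 1) (y i))
    orbit-bound i (s≤s 1≤i-1) i≤j = subst (λ r → AtLeast r (Run.Orb A φ (i ∸ 1) (y i)))
      (ℕ.+-comm 2 (j ∸ i)) (orbit-atLeast 1≤i-1 (ℕ.m∸n+n≡m i≤j))
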